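{- Let $G$ be an $\alpha$-weakly-Helly graph with injective hull $H=\mathcal{H}(G)$. For every integer $\ell\ge0$, $C^{\ell}(H)\cap V(G)\subseteq C^{\ell}(G)\subseteq C^{\ell+\alpha}(H)\cap V(G)$.
   Context: All graphs are finite, simple, undirected, unweighted and connected. A graph $G$ is $\alpha$-weakly-Helly if for every family of pairwise intersecting disks $\{D_G(v,r(v)) : v\in S\}$ (where $D_G(v,r)=\{u: d_G(u,v)\le r\}$) the disks $D_G(v,r(v)+\alpha)$, $v\in S$, have a common vertex; Helly graphs are the $0$-weakly-Helly graphs. The injective hull $\mathcal{H}(G)$ is the unique minimal Helly graph containing $G$ as an isometric subgraph; $V(G)$ is identified with its image. For a graph $X$, $e_X(v)$ is the eccentricity of $v$ in $X$, $rad(X)$ the minimum eccentricity, and $C^{\ell}(X)=\{v\in V(X): e_X(v)\le rad(X)+\ell\}$. -}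

module Defs where

open import Data.Nat using (ℕ; zero; suc; _+_; _≤_; _<_)
open import Data.Fin using (Fin)
open import Data.Fin.Subset using (Subset; _∈_)
open import Data.Bool using (Bool; true; false)
open import Data.Product using (Σ; ∃; _×_; _,_)
open import Relation.Binary.PropositionalEquality using (_≡_)
open import Relation.Nullary using (¬_)
open import Function.Bundles using (_⇔_)
open import Function.Definitions using (Surjective)

record Graph : Set where
  field
    n     : ℕ
    adj   : Fin n → Fin n → Bool
    sym   : ∀ u v → adj u v ≡ adj v u
    irref : ∀ v → adj v v ≡ false
open Graph public

V : Graph → Set
V G = Fin (n G)

data Walk (G : Graph) : V G → V G → ℕ → Set where
  here : ∀ {v} → Walk G v v zero
  step : ∀ {u w v k} → adj G u w ≡ true → Walk G w v k → Walk G u v (suc k)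

-- d_G(u,v) ≤ r, i.e. v ∈ D_G(u,r).
Near : (G : Graph) → V G → V G → ℕ → Set
Near G u v r = ∃ λ k → k ≤ r × Walk G u v k

-- Connected (and nonempty).
Connected : Graph → Set
Connected G = V G × (∀ u v → ∃ λ k → Walk G u v k)

WeaklyHelly : ℕ → Graph → Set
WeaklyHelly α G =
  (S : Subset (n G)) (r : V G → ℕ) →
  (∀ u v → u ∈ S → v ∈ S → ∃ λ x → Near G u x (r u) × Near G v x (r v)) →
  ∃ λ x → ∀ v → v ∈ S → Near G v x (r v + α)

Helly : Graph → Set
Helly = WeaklyHelly 0

Isometric : (G H : Graph) → (V G → V H) → Set
Isometric G H f = ∀ u v r → Near G u v r ⇔ Near H (f u) (f v) r

-- H (with embedding f of G) is the injective hull of G: H is a connected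
-- Helly graph containing G isometrically, and minimal: whenever a Helly graph
-- H' sits isometrically in H (via h) and contains G isometrically (via g,
-- compatibly with f), then h is onto, i.e. H' is all of H.
record IsInjectiveHull (G H : Graph) (f : V G → V H) : Set₁ where
  field
    hullConnected : Connected H
    hullHelly     : Helly H
    hullIsometric : Isometric G H f
    hullMinimal   : (H' : Graph) (g : V G → V H') (h : V H' → V H) →
      Connected H' → Helly H' → Isometric G H' g → Isometric H' H h →
      (∀ v → h (g v) ≡ f v) → Surjective _≡_ _≡_ h

Ecc : (X : Graph) → V X → ℕ → Set
Ecc X v e = (∀ u → Near X v u e) × (∀ e' → e' < e → ¬ (∀ u → Near X v u e'))

Rad : Graph → ℕ → Set
Rad X r = (∃ λ v → Ecc X v r) × (∀ w e → Ecc X w e → r ≤ e)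

InCenter : (ℓ : ℕ) (X : Graph) → V X → Set
InCenter ℓ X v = ∃ λ e → ∃ λ r → Ecc X v e × Rad X r × e ≤ r + ℓ

module Submission where

-- Let H be the injective hull of G, with G sitting isometrically in H via f.
-- The key fact is that eccentricities agree: e_H(f v) = e_G(v).  The bound
-- e_H(f v) ≥ e_G(v) is isometry; for e_H(f v) ≤ e_G(v) = E we use that in a
-- Helly graph every disk D_H(c,E), viewed as an induced subgraph, is itself
-- a connected Helly graph embedded isometrically (it is geodesically convex).
-- The disk D_H(f v,E) contains f(V G), so minimality of the hull forces it to
-- be all of H.  Consequently rad(H) ≤ rad(G), and α-weak-Hellyness applied to
-- the disks D_G(u, rad H) (pairwise intersecting, since any two vertices are
-- within 2·rad(H)) gives rad(G) ≤ rad(H) + α.  Both inclusions of the theorem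
-- are then arithmetic on these three facts.

open import Defs hiding (sym)
open import Data.Nat using (ℕ; zero; suc; _+_; _∸_; _≤_; _<_; z≤n; s≤s)
open import Data.Nat.Properties
open import Data.Fin using (Fin; zero; suc)
import Data.Fin.Properties as Fin
open import Data.Fin.Subset using (Subset; _∈_; ⊤)
open import Data.Fin.Subset.Properties using (_∈?_; ∈⊤; drop-there)
open import Data.Vec using (_∷_; here; there; tabulate)
open import Data.Vec.Properties using (lookup∘tabulate; []=⇒lookup; lookup⇒[]=)
open import Data.Bool using (true)
import Data.Bool as Bool
open import Data.List using (List; length; lookup; filter; allFin)
open import Data.List.Membership.Propositional.Properties using (∈-filter⁺; ∈-filter⁻; ∈-allFin; ∈-lookup)
open import Data.List.Relation.Unary.Any using (index)
open import Data.List.Relation.Unary.Any.Properties using (lookup-index)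
import Data.List.Relation.Unary.All as All
open import Data.List.Relation.Unary.Unique.Propositional using (Unique; _∷_)
open import Data.List.Relation.Unary.Unique.Propositional.Properties using (allFin⁺; filter⁺)
open import Data.Product using (∃; _×_; _,_; proj₁; proj₂)
open import Data.Sum using (_⊎_; inj₁; inj₂)
open import Data.Empty using (⊥-elim)
open import Relation.Binary.PropositionalEquality
open import Relation.Binary.Definitions using (tri<; tri≈; tri>)
open import Relation.Nullary using (¬_; Dec; yes; no; does)
open import Relation.Nullary.Decidable using (map′; _×-dec_; _⊎-dec_; dec-true)
open import Relation.Unary using (Decidable)
open import Function.Bundles using (mk⇔; Equivalence)
open Equivalence using (to; from)

module _ {G : Graph} where

  walk-++ : ∀ {u w v a b} → Walk G u w a → Walk G w v b → Walk G u v (a + b)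
  walk-++ here q = q
  walk-++ (step e p) q = step e (walk-++ p q)

  walk-snoc : ∀ {u w v k} → Walk G u w k → adj G w v ≡ true → Walk G u v (suc k)
  walk-snoc here e = step e here
  walk-snoc (step e′ p) e = step e′ (walk-snoc p e)

  walk-rev : ∀ {u v k} → Walk G u v k → Walk G v u k
  walk-rev here = here
  walk-rev {u} (step {w = w} e p) = walk-snoc (walk-rev p) (trans (Graph.sym G w u) e)

  walk-split : ∀ {u v k} → Walk G u v k → ∀ j → j ≤ k →
    ∃ λ x → Walk G u x j × Walk G x v (k ∸ j)
  walk-split p zero _ = _ , here , p
  walk-split (step e p) (suc j) (s≤s j≤k) =
    let (x , front , back) = walk-split p j j≤k in x , step e front , back

  near-refl : ∀ {u} r → Near G u u r
  near-refl r = 0 , z≤n , here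

  near-sym : ∀ {u v r} → Near G u v r → Near G v u r
  near-sym (k , k≤r , p) = k , k≤r , walk-rev p

  near-mono : ∀ {u v r s} → r ≤ s → Near G u v r → Near G u v s
  near-mono r≤s (k , k≤r , p) = k , ≤-trans k≤r r≤s , p

  near-trans : ∀ {u w v r s} → Near G u w r → Near G w v s → Near G u v (r + s)
  near-trans (a , a≤r , p) (b , b≤s , q) = a + b , +-mono-≤ a≤r b≤s , walk-++ p q

  near-step : ∀ {u w v r} → adj G u w ≡ true → Near G w v r → Near G u v (suc r)
  near-step e (k , k≤r , p) = suc k , s≤s k≤r , step e p

  near-zero : ∀ {u v} → Near G u v 0 → u ≡ v
  near-zero (zero , _ , here) = refl

  near-one : ∀ {u v} → Near G u v 1 → u ≡ v ⊎ adj G u v ≡ true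
  near-one (zero , _ , here) = inj₁ refl
  near-one (suc zero , _ , step e here) = inj₂ e
  near-one (suc (suc _) , s≤s () , _)

  near-midpoint : ∀ {u w} ρ → Near G u w (ρ + ρ) → ∃ λ x → Near G u x ρ × Near G w x ρ
  near-midpoint {w = w} ρ (k , k≤2ρ , p) with k ≤? ρ
  ... | yes k≤ρ = w , (k , k≤ρ , p) , near-refl ρ
  ... | no k≰ρ =
    let (x , front , back) = walk-split p ρ (<⇒≤ (≰⇒> k≰ρ))
    in x , (ρ , ≤-refl , front) , (k ∸ ρ , m≤n+o⇒m∸n≤o k ρ k≤2ρ , walk-rev back)

  -- Bounded distance is decidable: a walk of length ≤ r+1 is trivial or
  -- starts with an edge followed by a walk of length ≤ r.
  near? : ∀ u v r → Dec (Near G u v r)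
  near? u v zero = map′ (λ u≡v → subst (λ y → Near G u y 0) u≡v (near-refl 0)) near-zero (u Fin.≟ v)
  near? u v (suc r) =
    map′ join split (u Fin.≟ v ⊎-dec Fin.any? (λ w → adj G u w Bool.≟ true ×-dec near? w v r))
    where
      join : u ≡ v ⊎ (∃ λ w → adj G u w ≡ true × Near G w v r) → Near G u v (suc r)
      join (inj₁ refl) = near-refl (suc r)
      join (inj₂ (_ , e , near)) = near-step e near

      split : Near G u v (suc r) → u ≡ v ⊎ (∃ λ w → adj G u w ≡ true × Near G w v r)
      split (zero , _ , here) = inj₁ refl
      split (suc k , s≤s k≤r , step e p) = inj₂ (_ , e , k , k≤r , p)

Meet : (G : Graph) → V G → ℕ → V G → ℕ → Set
Meet G u r w s = ∃ λ x → Near G u x r × Near G w x s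

meet-refl : ∀ {G u} r → Meet G u r u r
meet-refl {u = u} r = u , near-refl r , near-refl r

meet-sym : ∀ {G u r w s} → Meet G u r w s → Meet G w s u r
meet-sym (x , ux , wx) = x , wx , ux

Least : (ℕ → Set) → ℕ → Set
Least Q e = Q e × (∀ e′ → e′ < e → ¬ Q e′)

least : (Q : ℕ → Set) → Decidable Q → ∀ B → Q B → ∃ (Least Q)
least Q Q? B q with Q? 0
... | yes q₀ = 0 , q₀ , λ _ ()
least Q Q? zero q | no ¬q₀ = ⊥-elim (¬q₀ q)
least Q Q? (suc B) q | no ¬q₀ =
  let (e , qe , below) = least (λ k → Q (suc k)) (λ k → Q? (suc k)) B q
  in suc e , qe , earlier below
  where
    earlier : ∀ {e} → (∀ e′ → e′ < e → ¬ Q (suc e′)) → ∀ e′ → e′ < suc e → ¬ Q e′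
    earlier below zero _ = ¬q₀
    earlier below (suc e′) (s≤s e′<e) = below e′ e′<e

least-unique : ∀ {Q e e′} → Least Q e → Least Q e′ → e ≡ e′
least-unique {e = e} {e′} (q , below) (q′ , below′) with <-cmp e e′
... | tri< e<e′ _ _ = ⊥-elim (below′ e e<e′ q)
... | tri≈ _ e≡e′ _ = e≡e′
... | tri> _ _ e′<e = ⊥-elim (below e′ e′<e q′)

uniform-bound : ∀ {k} (Q : Fin k → ℕ → Set) → (∀ {i a b} → a ≤ b → Q i a → Q i b) →
  (∀ i → ∃ (Q i)) → ∃ λ B → ∀ i → Q i B
uniform-bound {zero} Q mono witness = 0 , λ ()
uniform-bound {suc k} Q mono witness =
  let (a , qa) = witness zero
      (B , qB) = uniform-bound (λ i → Q (suc i)) mono (λ i → witness (suc i))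
  in a + B , λ { zero → mono (m≤m+n a B) qa ; (suc i) → mono (m≤n+m B a) (qB i) }

ecc-within : ∀ {X v B} → (∀ u → Near X v u B) → ∃ λ e → Ecc X v e × e ≤ B
ecc-within {X} {v} {B} within =
  let (e , ecc) = least (λ e → ∀ u → Near X v u e) (λ e → Fin.all? (λ u → near? v u e)) B within
  in e , ecc , ≮⇒≥ (λ B<e → proj₂ ecc B B<e within)

module _ {X : Graph} (conn : Connected X) where

  ecc-exists : ∀ v → ∃ (Ecc X v)
  ecc-exists v =
    let (B , within) = uniform-bound (Near X v) near-mono reach
        (e , ecc , _) = ecc-within within
    in e , ecc
    where
      reach : ∀ u → ∃ (Near X v u)
      reach u = let (k , p) = proj₂ conn v u in k , k , ≤-refl , p

  ecc? : ∀ w r → Dec (Ecc X w r)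
  ecc? w r =
    let (e , ecc) = ecc-exists w
    in map′ (λ r≡e → subst (Ecc X w) (sym r≡e) ecc) (λ ecc′ → least-unique ecc′ ecc) (r ≟ e)

  rad-exists : ∃ (Rad X)
  rad-exists =
    let v₀ = proj₁ conn
        (e₀ , ecc₀) = ecc-exists v₀
        (r , attained , below) =
          least (λ r → ∃ λ w → Ecc X w r) (λ r → Fin.any? (λ w → ecc? w r)) e₀ (v₀ , ecc₀)
    in r , attained , λ w e ecc → ≮⇒≥ (λ e<r → below e e<r (w , ecc))

toSubset : ∀ {k} {P : Fin k → Set} → Decidable P → Subset k
toSubset P? = tabulate (λ i → does (P? i))

toSubset-sound : ∀ {k} {P : Fin k → Set} (P? : Decidable P) {i} → i ∈ toSubset P? → P i
toSubset-sound P? {i} i∈ with P? i | trans (sym (lookup∘tabulate (λ j → does (P? j)) i)) ([]=⇒lookup i∈)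
... | yes p | _ = p
... | no _ | ()

toSubset-complete : ∀ {k} {P : Fin k → Set} (P? : Decidable P) {i} → P i → i ∈ toSubset P?
toSubset-complete P? {i} p =
  lookup⇒[]= i (toSubset P?) (trans (lookup∘tabulate (λ j → does (P? j)) i) (dec-true (P? i) p))

-- The defining property only speaks of
-- one disk per centre, so each centre is given the least radius of a disk of
-- the family centred there; that disk lies inside all the others at the
-- same centre.
module _ {H : Graph} (helly : Helly H) {k : ℕ} (I : Subset k) (cs : Fin k → V H) (rs : Fin k → ℕ) where
  private
    IsCentre : V H → Set
    IsCentre v = ∃ λ i → i ∈ I × cs i ≡ v

    isCentre? : Decidable IsCentre
    isCentre? v = Fin.any? (λ i → i ∈? I ×-dec cs i Fin.≟ v)

    RadiusAt : V H → ℕ → Set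
    RadiusAt v ρ = ∃ λ i → i ∈ I × cs i ≡ v × rs i ≡ ρ

    leastRadius : ∀ v → IsCentre v → ∃ (Least (RadiusAt v))
    leastRadius v (i , i∈I , cᵢ≡v) =
      least (RadiusAt v) (λ ρ → Fin.any? (λ j → j ∈? I ×-dec cs j Fin.≟ v ×-dec rs j ≟ ρ))
        (rs i) (i , i∈I , cᵢ≡v , refl)

    radius : V H → ℕ
    radius v with isCentre? v
    ... | yes centre = proj₁ (leastRadius v centre)
    ... | no _ = 0

    radius-spec : ∀ v → IsCentre v →
      RadiusAt v (radius v) × (∀ i → i ∈ I → cs i ≡ v → radius v ≤ rs i)
    radius-spec v centre with isCentre? v
    ... | no ¬centre = ⊥-elim (¬centre centre)
    ... | yes centre′ =
      let (_ , attained , below) = leastRadius v centre′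
      in attained , λ i i∈I cᵢ≡v → ≮⇒≥ (λ rᵢ< → below (rs i) rᵢ< (i , i∈I , cᵢ≡v , refl))

  helly-family : (∀ i j → i ∈ I → j ∈ I → Meet H (cs i) (rs i) (cs j) (rs j)) →
    ∃ λ x → ∀ i → i ∈ I → Near H (cs i) x (rs i)
  helly-family meets =
    let (x , near) = helly (toSubset isCentre?) radius disks-meet
    in x , λ i i∈I → near-mono (shrink i i∈I) (near (cs i) (toSubset-complete isCentre? (i , i∈I , refl)))
    where
      disks-meet : ∀ u w → u ∈ toSubset isCentre? → w ∈ toSubset isCentre? → Meet H u (radius u) w (radius w)
      disks-meet u w u∈ w∈
        with radius-spec u (toSubset-sound isCentre? u∈) | radius-spec w (toSubset-sound isCentre? w∈)
      ... | (i , i∈I , refl , rᵢ≡) , _ | (j , j∈I , refl , rⱼ≡) , _ =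
        let (x , ix , jx) = meets i j i∈I j∈I
        in x , subst (Near H (cs i) x) rᵢ≡ ix , subst (Near H (cs j) x) rⱼ≡ jx

      shrink : ∀ i → i ∈ I → radius (cs i) + 0 ≤ rs i
      shrink i i∈I = ≤-trans (≤-reflexive (+-identityʳ _)) (proj₂ (radius-spec (cs i) (i , i∈I , refl)) i i∈I refl)

helly-triple : ∀ {H} → Helly H → ∀ {a b c ra rb rc} →
  Meet H a ra b rb → Meet H a ra c rc → Meet H b rb c rc →
  ∃ λ x → Near H a x ra × Near H b x rb × Near H c x rc
helly-triple {H} helly {a} {b} {c} {ra} {rb} {rc} ab ac bc =
  let (x , near) = helly-family helly ⊤ cs rs (λ i j _ _ → meets i j)
  in x , near zero ∈⊤ , near (suc zero) ∈⊤ , near (suc (suc zero)) ∈⊤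
  where
    cs : Fin 3 → V H
    cs zero = a
    cs (suc zero) = b
    cs (suc (suc zero)) = c

    rs : Fin 3 → ℕ
    rs zero = ra
    rs (suc zero) = rb
    rs (suc (suc zero)) = rc

    meets : ∀ i j → Meet H (cs i) (rs i) (cs j) (rs j)
    meets zero zero = meet-refl ra
    meets zero (suc zero) = ab
    meets zero (suc (suc zero)) = ac
    meets (suc zero) zero = meet-sym ab
    meets (suc zero) (suc zero) = meet-refl rb
    meets (suc zero) (suc (suc zero)) = bc
    meets (suc (suc zero)) zero = meet-sym ac
    meets (suc (suc zero)) (suc zero) = meet-sym bc
    meets (suc (suc zero)) (suc (suc zero)) = meet-refl rc

lookup-injective : ∀ {A : Set} {xs : List A} → Unique xs → ∀ i j → lookup xs i ≡ lookup xs j → i ≡ j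
lookup-injective (_ ∷ _) zero zero _ = refl
lookup-injective (x∉xs ∷ _) zero (suc j) eq = ⊥-elim (All.lookup x∉xs (∈-lookup j) eq)
lookup-injective (x∉xs ∷ _) (suc i) zero eq = ⊥-elim (All.lookup x∉xs (∈-lookup i) (sym eq))
lookup-injective (_ ∷ unique) (suc i) (suc j) eq = cong suc (lookup-injective unique i j eq)

-- The subgraph of H induced by a decidable vertex set P.  Its vertices are
-- numbered by listing P; embed is injective with image exactly P, and walks
-- in the subgraph are walks in H.
module Induced (H : Graph) {P : V H → Set} (P? : Decidable P) where

  members : List (V H)
  members = filter P? (allFin (n H))

  embed : Fin (length members) → V H
  embed = lookup members

  embed-injective : ∀ a b → embed a ≡ embed b → a ≡ b
  embed-injective = lookup-injective (filter⁺ P? (allFin⁺ (n H)))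

  embed-∈ : ∀ a → P (embed a)
  embed-∈ a = proj₂ (∈-filter⁻ P? {xs = allFin (n H)} (∈-lookup a))

  embed-onto : ∀ x → P x → ∃ λ a → embed a ≡ x
  embed-onto x px =
    let x∈ = ∈-filter⁺ P? (∈-allFin x) px in index x∈ , sym (lookup-index x∈)

  subgraph : Graph
  subgraph = record
    { n = length members
    ; adj = λ a b → adj H (embed a) (embed b)
    ; sym = λ a b → Graph.sym H (embed a) (embed b)
    ; irref = λ a → irref H (embed a)
    }

  walk-down : ∀ {a b k} → Walk subgraph a b k → Walk H (embed a) (embed b) k
  walk-down here = here
  walk-down (step e p) = step e (walk-down p)

  near-down : ∀ {a b r} → Near subgraph a b r → Near H (embed a) (embed b) r
  near-down (k , k≤r , p) = k , k≤r , walk-down p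

module HellyDisk {H : Graph} (helly : Helly H) (c : V H) (E : ℕ) where
  open Induced H (λ x → near? {H} c x E) public

  disk : Graph
  disk = subgraph

  -- If embed b is within r of a neighbour w of embed a, then some disk
  -- vertex z is within 1 of embed a and within r of embed b: the disks
  -- D(embed a,1), D(embed b,r), D(c,E) pairwise meet.
  closer-vertex : ∀ {a b w r} → adj H (embed a) w ≡ true → Near H w (embed b) r →
    ∃ λ z → Near H (embed a) (embed z) 1 × Near H (embed z) (embed b) r
  closer-vertex {a} {b} {w} {r} e wb =
    let (x , ax , bx , cx) = helly-triple helly
          (w , near-step e (near-refl 0) , near-sym wb)
          (embed a , near-refl 1 , embed-∈ a)
          (embed b , near-refl r , embed-∈ b)
        (z , z↦x) = embed-onto x cx
    in z , subst (λ y → Near H (embed a) y 1) (sym z↦x) ax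
         , near-sym (subst (λ y → Near H (embed b) y r) (sym z↦x) bx)

  extend : ∀ {a z b r} → Near H (embed a) (embed z) 1 → Near disk z b r → Near disk a b (suc r)
  extend {a} {z} {b} {r} az zb with near-one az
  ... | inj₁ a↦z = near-mono (n≤1+n r) (subst (λ y → Near disk y b r) (sym (embed-injective a z a↦z)) zb)
  ... | inj₂ e = near-step e zb

  near-inside : ∀ r {a b} → Near H (embed a) (embed b) r → Near disk a b r
  near-inside r {a} {b} (zero , _ , p) =
    subst (λ y → Near disk a y r) (embed-injective a b (near-zero (0 , z≤n , p))) (near-refl r)
  near-inside zero (suc _ , () , _)
  near-inside (suc r) (suc k , s≤s k≤r , step e p) =
    let (z , az , zb) = closer-vertex e (k , k≤r , p) in extend az (near-inside r zb)

  disk-isometric : Isometric disk H embed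
  disk-isometric a b r = mk⇔ near-down (near-inside r)

  disk-connected : Connected disk
  disk-connected =
    proj₁ (embed-onto c (near-refl E)) ,
    λ a b → let (k , _ , p) = near-inside (E + E) (near-trans (near-sym (embed-∈ a)) (embed-∈ b)) in k , p

  -- A pairwise intersecting family of disks of the subgraph, together with
  -- D(c,E), is a pairwise intersecting family in H; a common vertex of it
  -- lies in the disk.
  disk-helly : Helly disk
  disk-helly S r meets =
    let (x , near) = helly-family helly (true ∷ S) cs rs family-meets
        (z , z↦x) = embed-onto x (near zero here)
    in z , λ a a∈S →
         subst (Near disk a z) (sym (+-identityʳ (r a)))
           (near-inside (r a) (subst (λ y → Near H (embed a) y (r a)) (sym z↦x) (near (suc a) (there a∈S))))
    where
      cs : Fin (suc (length members)) → V H
      cs zero = c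
      cs (suc a) = embed a

      rs : Fin (suc (length members)) → ℕ
      rs zero = E
      rs (suc a) = r a

      family-meets : ∀ i j → i ∈ true ∷ S → j ∈ true ∷ S → Meet H (cs i) (rs i) (cs j) (rs j)
      family-meets zero zero _ _ = meet-refl E
      family-meets zero (suc b) _ _ = embed b , embed-∈ b , near-refl (r b)
      family-meets (suc a) zero _ _ = embed a , near-refl (r a) , embed-∈ a
      family-meets (suc a) (suc b) a∈ b∈ =
        let (x , ax , bx) = meets a b (drop-there a∈) (drop-there b∈)
        in embed x , near-down ax , near-down bx

isometric-factor : ∀ {G H′ H : Graph} {f : V G → V H} {g : V G → V H′} {h : V H′ → V H} →
  Isometric G H f → Isometric H′ H h → (∀ v → h (g v) ≡ f v) → Isometric G H′ g
isometric-factor {H = H} {f} {g} {h} iso-f iso-h h∘g u w r = mk⇔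
  (λ near → from (iso-h (g u) (g w) r) (subst₂ (λ x y → Near H x y r) (sym (h∘g u)) (sym (h∘g w)) (to (iso-f u w r) near)))
  (λ near → from (iso-f u w r) (subst₂ (λ x y → Near H x y r) (h∘g u) (h∘g w) (to (iso-h (g u) (g w) r) near)))

-- The disk D_H(f v, E) is a connected Helly graph,
-- isometric in H, containing f(V G); by minimality of the hull it is all of H.
hull-covered : ∀ {G H f} → IsInjectiveHull G H f →
  ∀ v E → (∀ u → Near G v u E) → ∀ x → Near H (f v) x E
hull-covered {G} {H} {f} hull v E within x =
  let (a , onto) = hullMinimal disk lift embed disk-connected disk-helly
                     (isometric-factor hullIsometric disk-isometric lift-embeds) disk-isometric lift-embeds x
  in subst (λ y → Near H (f v) y E) (onto refl) (embed-∈ a)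
  where
    open IsInjectiveHull hull
    open HellyDisk hullHelly (f v) E

    lift : V G → V disk
    lift u = proj₁ (embed-onto (f u) (to (hullIsometric v u E) (within u)))

    lift-embeds : ∀ u → embed (lift u) ≡ f u
    lift-embeds u = proj₂ (embed-onto (f u) (to (hullIsometric v u E) (within u)))

module HullCentres {G H : Graph} {f : V G → V H} (hull : IsInjectiveHull G H f) where
  open IsInjectiveHull hull

  ecc-to-hull : ∀ {v e} → Ecc G v e → Ecc H (f v) e
  ecc-to-hull {v} {e} (within , minimal) =
    hull-covered hull v e within ,
    λ e′ e′<e within′ → minimal e′ e′<e (λ u → from (hullIsometric v u e′) (within′ (f u)))

  ecc-from-hull : ∀ {v e} → Ecc H (f v) e → Ecc G v e
  ecc-from-hull {v} {e} (within , minimal) =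
    (λ u → from (hullIsometric v u e) (within (f u))) ,
    λ e′ e′<e within′ → minimal e′ e′<e (hull-covered hull v e′ within′)

  -- rad(H) ≤ rad(G): a centre of G keeps its eccentricity in H.
  rad-hull-≤ : ∀ {rG rH} → Rad G rG → Rad H rH → rH ≤ rG
  rad-hull-≤ {rG} ((w , ecc-w) , _) (_ , minimal) = minimal (f w) rG (ecc-to-hull ecc-w)

  -- rad(G) ≤ rad(H) + α: the disks D_G(u, rad H) pairwise meet, because any
  -- two vertices of G are within 2·rad(H) through a centre of H; a vertex
  -- within α of all of them has eccentricity ≤ rad(H) + α.
  rad-≤-hull : ∀ {α rG rH} → WeaklyHelly α G → Rad G rG → Rad H rH → rG ≤ rH + α
  rad-≤-hull {α} {rG} {rH} weakly-helly (_ , minimal) ((c , ecc-c) , _) =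
    let (x , near-x) = weakly-helly ⊤ (λ _ → rH) disks-meet
        (e , ecc-x , e≤) = ecc-within (λ u → near-sym (near-x u ∈⊤))
    in ≤-trans (minimal x e ecc-x) e≤
    where
      disks-meet : ∀ u w → u ∈ ⊤ → w ∈ ⊤ → Meet G u rH w rH
      disks-meet u w _ _ = near-midpoint rH
        (from (hullIsometric u w (rH + rH)) (near-trans (near-sym (proj₁ ecc-c (f u))) (proj₁ ecc-c (f w))))

corollary3 : (α : ℕ) (G H : Graph) (f : V G → V H) →
    Connected G → WeaklyHelly α G → IsInjectiveHull G H f →
    (ℓ : ℕ) (v : V G) →
    (InCenter ℓ H (f v) → InCenter ℓ G v) × (InCenter ℓ G v → InCenter (ℓ + α) H (f v))
corollary3 α G H f connected weakly-helly hull ℓ v = inward , outward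
  where
    open HullCentres hull
    open IsInjectiveHull hull using (hullConnected)

    inward : InCenter ℓ H (f v) → InCenter ℓ G v
    inward (e , rH , ecc-H , rad-H , e≤) =
      let (rG , rad-G) = rad-exists connected
      in e , rG , ecc-from-hull ecc-H , rad-G , ≤-trans e≤ (+-monoˡ-≤ ℓ (rad-hull-≤ rad-G rad-H))

    outward : InCenter ℓ G v → InCenter (ℓ + α) H (f v)
    outward (e , rG , ecc-G , rad-G , e≤) =
      let (rH , rad-H) = rad-exists hullConnected
          bound = begin
            e             ≤⟨ e≤ ⟩
            rG + ℓ        ≤⟨ +-monoˡ-≤ ℓ (rad-≤-hull weakly-helly rad-G rad-H) ⟩
            rH + α + ℓ    ≡⟨ +-assoc rH α ℓ ⟩
            rH + (α + ℓ)  ≡⟨ cong (rH +_) (+-comm α ℓ) ⟩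
            rH + (ℓ + α)  ∎
      in e , rH , ecc-to-hull ecc-G , rad-H , bound
      where open ≤-Reasoning
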